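{- Let $\mathcal L$ be a finite, atomic and graded lattice and let $B$ be a basis of $\mathcal L$. Then for every atom $a\in A(\mathcal L)\setminus B$, the set $B\cup\{a\}$ contains a unique minimal (with respect to inclusion) dependent set.
   Context: Graded: $\mathcal L$ has least element $\hat0$, greatest element $\hat1$ and a rank function with $\mathrm{rank}(\hat0)=0$, order-preserving, increasing by exactly $1$ along covering relations. Atoms are elements covering $\hat0$, $A(\mathcal L)$ is the set of atoms, atomic means every element is a join of atoms. For a linear order $\omega$ on $A(\mathcal L)$, a nonempty set $D$ of atoms is bounded below if some atom $a$ is strictly smaller than all $d\in D$ in $\omega$ and $a\le\bigvee D$; a set of atoms is NBB for $\omega$ if it contains no bounded below subset. $I(\mathcal L)$ is the family of sets of atoms that are NBB for at least one linear order; its members are called independent and all other sets of atoms dependent. An independent set $I$ is geometric if $\mathrm{rank}(\bigvee I)=|I|$. A basis of $\mathcal L$ is an inclusion-maximal member of $I(\mathcal L)$ all of whose subsets are geometric. -}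

module Defs where

open import Level using (0ℓ)
open import Data.Nat using (ℕ; suc) renaming (_≤_ to _≤ℕ_)
open import Data.Fin using (Fin)
open import Data.Fin.Subset using (Subset; _∈_; _∉_; _⊆_; ∣_∣; Nonempty)
open import Data.Vec using (lookup)
open import Data.List using (foldr)
open import Data.List using () renaming (allFin to allFinL)
open import Data.Bool using (if_then_else_)
open import Data.Product using (Σ; ∃; _×_; ∃-syntax; proj₁)
open import Relation.Nullary using (¬_)
open import Relation.Binary.Core using (Rel)
open import Relation.Binary.PropositionalEquality using (_≡_)
open import Relation.Binary.Structures using (IsStrictTotalOrder)
open import Relation.Binary.Lattice.Structures using (IsBoundedLattice)
open import Algebra.Core using (Op₂)

-- A finite lattice, presented (up to isomorphism) on the carrier Fin n,
-- with propositional equality as the underlying equality.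
record FinLattice : Set₁ where
  field
    n     : ℕ
    _≤_   : Rel (Fin n) 0ℓ
    _∨_   : Op₂ (Fin n)
    _∧_   : Op₂ (Fin n)
    ⊤     : Fin n
    ⊥     : Fin n
    isBoundedLattice : IsBoundedLattice _≡_ _≤_ _∨_ _∧_ ⊤ ⊥

module _ (L : FinLattice) where
  open FinLattice L

  _<_ : Rel (Fin n) 0ℓ
  x < y = x ≤ y × ¬ (x ≡ y)

  _⋖_ : Rel (Fin n) 0ℓ
  x ⋖ y = x < y × ¬ (∃[ z ] (x < z × z < y))

  IsAtom : Fin n → Set
  IsAtom x = ⊥ ⋖ x

  AtomSet : Subset n → Set
  AtomSet S = ∀ {i} → i ∈ S → IsAtom i

  ⋁ : Subset n → Fin n
  ⋁ S = foldr (λ i acc → if lookup S i then i ∨ acc else acc) ⊥ (allFinL n)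

  IsRankFunction : (Fin n → ℕ) → Set
  IsRankFunction rank =
    rank ⊥ ≡ 0 ×
    (∀ {x y} → x ≤ y → rank x ≤ℕ rank y) ×
    (∀ {x y} → x ⋖ y → rank y ≡ suc (rank x))

  Graded : Set
  Graded = ∃[ rank ] IsRankFunction rank

  Atomic : Set
  Atomic = ∀ x → ∃[ S ] (AtomSet S × ⋁ S ≡ x)

  -- linear orders on the atoms: represented by strict total orders on the
  -- whole carrier (only their restriction to the atoms matters)
  LinearOrder : Set₁
  LinearOrder = Σ (Rel (Fin n) 0ℓ) (IsStrictTotalOrder _≡_)

  module _ (ω : LinearOrder) where
    private
      _<ω_ = proj₁ ω

    BoundedBelow : Subset n → Set
    BoundedBelow D =
      Nonempty D ×
      ∃[ a ] (IsAtom a × (∀ {d} → d ∈ D → a <ω d) × a ≤ ⋁ D)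

    NBB : Subset n → Set
    NBB S = ∀ D → D ⊆ S → ¬ BoundedBelow D

  Independent : Subset n → Set₁
  Independent S = AtomSet S × ∃[ ω ] NBB ω S

  Dependent : Subset n → Set₁
  Dependent S = AtomSet S × ¬ Independent S

  Geometric : (Fin n → ℕ) → Subset n → Set₁
  Geometric rank I = Independent I × rank (⋁ I) ≡ ∣ I ∣

  IsBasis : (Fin n → ℕ) → Subset n → Set₁
  IsBasis rank B =
    Independent B ×
    (∀ J → Independent J → B ⊆ J → J ≡ B) ×
    (∀ J → J ⊆ B → Geometric rank J)

  MinimalDependent : Subset n → Set₁
  MinimalDependent D = Dependent D × (∀ D′ → D′ ⊆ D → Dependent D′ → D′ ≡ D)

-- Since B is maximal, a ≤ ⋁ B: otherwise putting a in front of a linear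
-- order witnessing that B is NBB shows B ∪ {a} independent.  Shrink B to a
-- minimal S with a ≤ ⋁ S.  Every subset of B is geometric, so ranks count
-- elements; this forces s ≤ a ∨ ⋁ (S - s) for each s ∈ S and puts S inside
-- every T ⊆ B with a ≤ ⋁ T.  Hence each element of C = S ∪ {a} lies below the
-- join of the others, so for any linear order the least element of C bounds
-- the rest of C from below: C is dependent.  Conversely a dependent
-- D ⊆ B ∪ {a} contains a and satisfies a ≤ ⋁ (D ∩ B), since otherwise the
-- same front-insertion makes D independent; therefore C ⊆ D.
module Submission where

open import Defs hiding (_<_)
open import Level using (_⊔_; 0ℓ)
open import Data.Nat using (ℕ)
import Data.Nat as ℕ
import Data.Nat.Properties as ℕₚ
open import Data.Fin using (Fin)
import Data.Fin as Fin
open import Data.Fin.Properties using (any?)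
open import Data.Fin.Subset
  using (Subset; _∈_; _∉_; _⊆_; _⊂_; _∪_; _∩_; _─_; _-_; ⁅_⁆; ∣_∣; Nonempty; inside; outside)
open import Data.Fin.Subset.Properties
open import Data.Fin.Subset.Induction using (⊂-wellFounded)
open import Data.Vec using (_∷_; lookup; tabulate; here; there)
open import Data.Vec.Properties using (lookup∘tabulate; []=⇒lookup; lookup⇒[]=)
open import Data.List using (List; _∷_; foldr; filter; allFin)
open import Data.List.Membership.Propositional using () renaming (_∈_ to _∈ᴸ_)
open import Data.List.Membership.Propositional.Properties using (∈-allFin; ∈-filter⁺)
open import Data.List.Properties using (foldr-preservesʳ)
import Data.List.Relation.Unary.All as All
open import Data.List.Relation.Unary.All.Properties using (all-filter)
import Data.List.Relation.Unary.Any as Any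
import Data.List.Extrema
open import Data.Bool using (true; false; if_then_else_)
open import Data.Product using (_×_; _,_; proj₁; proj₂; ∃-syntax)
open import Data.Sum as Sum using (_⊎_; inj₁; inj₂; [_,_]′)
open import Data.Empty using (⊥; ⊥-elim)
open import Function using (id; _∘_)
open import Induction.WellFounded using (Acc; acc)
open import Relation.Nullary using (¬_; Dec; yes; no; does)
open import Relation.Nullary.Decidable using (_×-dec_; ¬?; decidable-stable; dec-true)
import Relation.Nullary.Decidable as Dec
open import Relation.Unary using (Pred; Decidable)
open import Relation.Binary.Core using (Rel)
open import Relation.Binary.Definitions using (Transitive; Trichotomous; tri<; tri≈; tri>)
open import Relation.Binary.PropositionalEquality
  using (_≡_; _≢_; refl; sym; trans; subst; cong; isEquivalence; resp₂)
open import Relation.Binary.Structures using (IsStrictTotalOrder)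
open import Relation.Binary.Bundles using (TotalOrder)
open import Relation.Binary.Lattice.Bundles using (BoundedLattice)
open import Relation.Binary.Lattice.Structures using (IsBoundedLattice)
import Relation.Binary.Construct.StrictToNonStrict as StrictToNonStrict
import Relation.Binary.Properties.Poset as PosetProperties

private
  variable
    n : ℕ

x∈p─q⇒x∉q : ∀ {x : Fin n} {p q} → x ∈ p ─ q → x ∉ q
x∈p─q⇒x∉q {p = _ ∷ _} {inside ∷ _} () here
x∈p─q⇒x∉q {p = _ ∷ _} {_ ∷ _} (there x∈p─q) (there x∈q) = x∈p─q⇒x∉q x∈p─q x∈q

x∈p-y⇒x≢y : ∀ {x y : Fin n} {p} → x ∈ p - y → x ≢ y
x∈p-y⇒x≢y {x = x} x∈p-y refl = x∈p─q⇒x∉q x∈p-y (x∈⁅x⁆ x)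

x∈p∪⁅y⁆⇒x∈p⊎x≡y : ∀ {x y : Fin n} {p} → x ∈ p ∪ ⁅ y ⁆ → x ∈ p ⊎ x ≡ y
x∈p∪⁅y⁆⇒x∈p⊎x≡y {y = y} {p} = Sum.map₂ (x∈⁅y⁆⇒x≡y y) ∘ x∈p∪q⁻ p ⁅ y ⁆

p⊆q⇒p─r⊆q─r : ∀ {p q r : Subset n} → p ⊆ q → p ─ r ⊆ q ─ r
p⊆q⇒p─r⊆q─r {p = p} {r = r} p⊆q x∈p─r =
  x∈p∧x∉q⇒x∈p─q (p⊆q (p─q⊆p p r x∈p─r)) (x∈p─q⇒x∉q x∈p─r)

x∈p⇒∣p∣≡1+∣p-x∣ : ∀ {x} {p : Subset n} → x ∈ p → ∣ p ∣ ≡ ℕ.suc ∣ p - x ∣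
x∈p⇒∣p∣≡1+∣p-x∣ {p = inside ∷ p} here = cong ℕ.suc (cong ∣_∣ (sym (p─⊥≡p p)))
x∈p⇒∣p∣≡1+∣p-x∣ {p = inside ∷ _} (there x∈p) = cong ℕ.suc (x∈p⇒∣p∣≡1+∣p-x∣ x∈p)
x∈p⇒∣p∣≡1+∣p-x∣ {p = outside ∷ _} (there x∈p) = x∈p⇒∣p∣≡1+∣p-x∣ x∈p

module _ {ℓ} {P : Pred (Fin n) ℓ} (P? : Decidable P) where

  fromDec : Subset n
  fromDec = tabulate (does ∘ P?)

  ∈-fromDec⁺ : ∀ {x} → P x → x ∈ fromDec
  ∈-fromDec⁺ {x} px = lookup⇒[]= x fromDec (trans (lookup∘tabulate _ x) (dec-true (P? x) px))

  ∈-fromDec⁻ : ∀ {x} → x ∈ fromDec → P x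
  ∈-fromDec⁻ {x} x∈ = from-does (P? x) (trans (sym (lookup∘tabulate _ x)) ([]=⇒lookup x∈))
    where
    from-does : (d : Dec (P x)) → does d ≡ true → P x
    from-does (yes px) _ = px
    from-does (no _) ()

minimal-subset : ∀ {ℓ} {P : Pred (Subset n) ℓ} → Decidable P → ∀ {T} → P T →
                 ∃[ S ] (S ⊆ T × P S × (∀ {s} → s ∈ S → ¬ P (S - s)))
minimal-subset {P = P} P? {T} PT = go T PT (⊂-wellFounded T)
  where
  go : ∀ T → P T → Acc _⊂_ T → ∃[ S ] (S ⊆ T × P S × (∀ {s} → s ∈ S → ¬ P (S - s)))
  go T PT (acc smaller) with any? (λ s → s ∈? T ×-dec P? (T - s))
  ... | no ∄s = T , ⊆-refl , PT , λ s∈T PT-s → ∄s (_ , s∈T , PT-s)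
  ... | yes (s , s∈T , PT-s) with go (T - s) PT-s (smaller (x∈p⇒p-x⊂p s∈T))
  ...   | S , S⊆T-s , PS , minimal = S , ⊆-trans S⊆T-s (p─q⊆p T ⁅ s ⁆) , PS , minimal

module _ {ℓ} {_<_ : Rel (Fin n) ℓ} (sto : IsStrictTotalOrder _≡_ _<_) where

  private
    totalOrder : TotalOrder 0ℓ 0ℓ ℓ
    totalOrder = record { isTotalOrder = StrictToNonStrict.isTotalOrder _≡_ _<_ sto }

  open Data.List.Extrema totalOrder using (min; min≤xs; argmin-all)

  least-element : ∀ {x} (p : Subset n) → x ∈ p → ∃[ m ] (m ∈ p × (∀ {y} → y ∈ p → m < y ⊎ m ≡ y))
  least-element {x} p x∈p =
    min x elements ,
    argmin-all id x∈p (all-filter (_∈? p) (allFin _)) ,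
    λ y∈p → All.lookup (min≤xs x elements) (∈-filter⁺ (_∈? p) (∈-allFin _) y∈p)
    where
    elements : List (Fin n)
    elements = filter (_∈? p) (allFin _)

Front : ∀ {a ℓ} {A : Set a} → A → Rel A ℓ → Rel A (a ⊔ ℓ)
Front a _<_ x y = y ≢ a × (x ≡ a ⊎ x < y)

Front-isStrictTotalOrder : ∀ {a ℓ} {A : Set a} {_<_ : Rel A ℓ} (a : A) →
                           IsStrictTotalOrder _≡_ _<_ → IsStrictTotalOrder _≡_ (Front a _<_)
Front-isStrictTotalOrder {_<_ = _<_} a sto = record
  { isStrictPartialOrder = record
    { isEquivalence = isEquivalence
    ; irrefl = λ { refl (x≢a , x<x) → [ x≢a , <-irrefl refl ]′ x<x }
    ; trans = front-trans
    ; <-resp-≈ = resp₂ _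
    }
  ; compare = front-compare
  }
  where
  open IsStrictTotalOrder sto using (compare; _≟_) renaming (irrefl to <-irrefl; trans to <-trans)

  front-trans : Transitive (Front a _<_)
  front-trans (_ , inj₁ x≡a) (z≢a , _) = z≢a , inj₁ x≡a
  front-trans (y≢a , inj₂ _) (_ , inj₁ y≡a) = ⊥-elim (y≢a y≡a)
  front-trans (_ , inj₂ x<y) (z≢a , inj₂ y<z) = z≢a , inj₂ (<-trans x<y y<z)

  front-compare : Trichotomous _≡_ (Front a _<_)
  front-compare x y with x ≟ a | y ≟ a
  ... | yes refl | yes refl = tri≈ (λ (a≢a , _) → a≢a refl) refl (λ (a≢a , _) → a≢a refl)
  ... | yes refl | no y≢a = tri< (y≢a , inj₁ refl) (y≢a ∘ sym) (λ (a≢a , _) → a≢a refl)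
  ... | no x≢a | yes refl = tri> (λ (a≢a , _) → a≢a refl) x≢a (x≢a , inj₁ refl)
  ... | no x≢a | no y≢a with compare x y
  ...   | tri< x<y x≢y x≯y = tri< (y≢a , inj₂ x<y) x≢y (λ (_ , y<x) → [ y≢a , x≯y ]′ y<x)
  ...   | tri≈ x≮y x≡y x≯y = tri≈ (λ (_ , x<y) → [ x≢a , x≮y ]′ x<y) x≡y (λ (_ , y<x) → [ y≢a , x≯y ]′ y<x)
  ...   | tri> x≮y x≢y y<x = tri> (λ (_ , x<y) → [ x≢a , x≮y ]′ x<y) x≢y (x≢a , inj₂ y<x)

module Lattice (L : FinLattice) where
  open FinLattice L renaming (⊥ to 0̂; n to N)
  open IsBoundedLattice isBoundedLattice
    using (x≤x∨y; y≤x∨y; ∨-least; x∧y≤x; x∧y≤y; ∧-greatest; minimum; antisym)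
    renaming (refl to ≤-refl; trans to ≤-trans)

  private
    boundedLattice : BoundedLattice 0ℓ 0ℓ 0ℓ
    boundedLattice = record { isBoundedLattice = isBoundedLattice }

  open PosetProperties (BoundedLattice.poset boundedLattice) using (_<_; <-trans; <-irrefl; <⇒≱)

  _≤?_ : ∀ x y → Dec (x ≤ y)
  x ≤? y = Dec.map′ (λ x∧y≡x → subst (_≤ y) x∧y≡x (x∧y≤y x y))
                    (λ x≤y → antisym (x∧y≤x x y) (∧-greatest ≤-refl x≤y))
                    ((x ∧ y) Fin.≟ x)

  _<?_ : ∀ x y → Dec (x < y)
  x <? y = x ≤? y ×-dec ¬? (x Fin.≟ y)

  private
    join-step : Subset N → Fin N → Fin N → Fin N
    join-step S i j = if lookup S i then i ∨ j else j

    y≤join-step : ∀ S i y → y ≤ join-step S i y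
    y≤join-step S i y with lookup S i
    ... | true = y≤x∨y i y
    ... | false = ≤-refl

  ∈⇒≤⋁ : ∀ {S i} → i ∈ S → i ≤ ⋁ L S
  ∈⇒≤⋁ {S} {i} i∈S = go (allFin N) (∈-allFin i)
    where
    go : ∀ xs → i ∈ᴸ xs → i ≤ foldr (join-step S) 0̂ xs
    go (x ∷ xs) (Any.here refl) rewrite []=⇒lookup i∈S = x≤x∨y i _
    go (x ∷ xs) (Any.there i∈xs) = ≤-trans (go xs i∈xs) (y≤join-step S x _)

  ⋁-least : ∀ {S z} → (∀ {i} → i ∈ S → i ≤ z) → ⋁ L S ≤ z
  ⋁-least {S} {z} bound = foldr-preservesʳ step (minimum z) (allFin N)
    where
    step : ∀ i {y} → y ≤ z → join-step S i y ≤ z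
    step i y≤z with lookup S i in i∈?S
    ... | true = ∨-least (bound (lookup⇒[]= i S i∈?S)) y≤z
    ... | false = y≤z

  ⋁-mono : ∀ {S T} → S ⊆ T → ⋁ L S ≤ ⋁ L T
  ⋁-mono S⊆T = ⋁-least (∈⇒≤⋁ ∘ S⊆T)

  AtomSet-∪⁅⁆ : ∀ {P a} → AtomSet L P → IsAtom L a → AtomSet L (P ∪ ⁅ a ⁆)
  AtomSet-∪⁅⁆ P-atoms a-atom i∈ with x∈p∪⁅y⁆⇒x∈p⊎x≡y i∈
  ... | inj₁ i∈P = P-atoms i∈P
  ... | inj₂ refl = a-atom

  Independent-⊆ : ∀ {S T} → Independent L S → T ⊆ S → Independent L T
  Independent-⊆ (S-atoms , ω , nbb) T⊆S = S-atoms ∘ T⊆S , ω , λ D D⊆T → nbb D (⊆-trans D⊆T T⊆S)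

  _◃_ : Fin N → LinearOrder L → LinearOrder L
  a ◃ ω = Front a (proj₁ ω) , Front-isStrictTotalOrder a (proj₂ ω)

  NBB-∪⁅⁆ : ∀ {ω P a} → NBB L ω P → ¬ a ≤ ⋁ L P → NBB L (a ◃ ω) (P ∪ ⁅ a ⁆)
  NBB-∪⁅⁆ {ω} {P} {a} nbb a≰⋁P E E⊆ (E≢∅ , c , c-atom , c<E , c≤⋁E) = go (c Fin.≟ a)
    where
    -- a cannot lie in E, since nothing comes before a in a ◃ ω.
    E⊆P : E ⊆ P
    E⊆P d∈E = [ id , (λ d≡a → ⊥-elim (proj₁ (c<E d∈E) d≡a)) ]′ (x∈p∪⁅y⁆⇒x∈p⊎x≡y (E⊆ d∈E))

    go : Dec (c ≡ a) → ⊥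
    go (yes refl) = a≰⋁P (≤-trans c≤⋁E (⋁-mono E⊆P))
    go (no c≢a) = nbb E E⊆P (E≢∅ , c , c-atom , [ ⊥-elim ∘ c≢a , id ]′ ∘ proj₂ ∘ c<E , c≤⋁E)

  Independent-∪⁅⁆ : ∀ {P a} → Independent L P → IsAtom L a → ¬ a ≤ ⋁ L P →
                    Independent L (P ∪ ⁅ a ⁆)
  Independent-∪⁅⁆ {P} {a} (P-atoms , ω , nbb) a-atom a≰⋁P =
    AtomSet-∪⁅⁆ {P} P-atoms a-atom , a ◃ ω , NBB-∪⁅⁆ {ω} {P} nbb a≰⋁P

  spanning⇒¬NBB : ∀ ω {D x} → AtomSet L D → x ∈ D → (∀ {d} → d ∈ D → d ≤ ⋁ L (D - d)) →
                  ¬ NBB L ω D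
  spanning⇒¬NBB (_<ω_ , sto) {D} D-atoms x∈D spanning nbb =
    nbb (D - m) (p─q⊆p D ⁅ m ⁆) (D-m≢∅ , m , D-atoms m∈D , m<D-m , spanning m∈D)
    where
    least : ∃[ m ] (m ∈ D × (∀ {y} → y ∈ D → m <ω y ⊎ m ≡ y))
    least = least-element sto D x∈D

    m : Fin N
    m = proj₁ least

    m∈D : m ∈ D
    m∈D = proj₁ (proj₂ least)

    m<D-m : ∀ {d} → d ∈ D - m → m <ω d
    m<D-m d∈D-m = [ id , (λ m≡d → ⊥-elim (x∈p-y⇒x≢y d∈D-m (sym m≡d))) ]′
                    (proj₂ (proj₂ least) (p─q⊆p D ⁅ m ⁆ d∈D-m))

    -- m is an atom, so m ≤ ⋁ (D - m) forces D - m to be nonempty.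
    D-m≢∅ : Nonempty (D - m)
    D-m≢∅ = decidable-stable (nonempty? (D - m)) λ D-m≡∅ →
      proj₂ (proj₁ (D-atoms m∈D))
        (antisym (minimum m) (≤-trans (spanning m∈D) (⋁-least (λ {i} i∈ → ⊥-elim (D-m≡∅ (i , i∈))))))

  ⟨_,_] : Fin N → Fin N → Subset N
  ⟨ u , v ] = fromDec (λ w → u <? w ×-dec w ≤? v)

  ∈⟨,]⁺ : ∀ {u v w} → u < w → w ≤ v → w ∈ ⟨ u , v ]
  ∈⟨,]⁺ {u} {v} u<w w≤v = ∈-fromDec⁺ (λ w → u <? w ×-dec w ≤? v) (u<w , w≤v)

  ∈⟨,]⁻ : ∀ {u v w} → w ∈ ⟨ u , v ] → u < w × w ≤ v
  ∈⟨,]⁻ {u} {v} = ∈-fromDec⁻ (λ w → u <? w ×-dec w ≤? v)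

  module Ranked (rank : Fin N → ℕ) (rank-⋖ : ∀ {x y} → _⋖_ L x y → rank y ≡ ℕ.suc (rank x)) where

    rank-strict : ∀ {u v} → u < v → rank u ℕ.< rank v
    rank-strict {u} {v} = go (⊂-wellFounded ⟨ u , v ])
      where
      go : ∀ {u v} → Acc _⊂_ ⟨ u , v ] → u < v → rank u ℕ.< rank v
      go {u} {v} (acc smaller) u<v with any? (λ z → u <? z ×-dec z <? v)
      ... | no ∄z = ℕₚ.≤-reflexive (sym (rank-⋖ (u<v , ∄z)))
      ... | yes (z , u<z , z<v) = ℕₚ.<-trans (go (smaller ⟨u,z]⊂⟨u,v]) u<z) (go (smaller ⟨z,v]⊂⟨u,v]) z<v)
        where
        ⟨u,z]⊂⟨u,v] : ⟨ u , z ] ⊂ ⟨ u , v ]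
        ⟨u,z]⊂⟨u,v] =
          (λ w∈ → let (u<w , w≤z) = ∈⟨,]⁻ w∈ in ∈⟨,]⁺ u<w (≤-trans w≤z (proj₁ z<v))) ,
          v , ∈⟨,]⁺ u<v ≤-refl , λ v∈ → <⇒≱ z<v (proj₂ (∈⟨,]⁻ v∈))

        ⟨z,v]⊂⟨u,v] : ⟨ z , v ] ⊂ ⟨ u , v ]
        ⟨z,v]⊂⟨u,v] =
          (λ w∈ → let (z<w , w≤v) = ∈⟨,]⁻ w∈ in ∈⟨,]⁺ (<-trans u<z z<w) w≤v) ,
          z , ∈⟨,]⁺ u<z (proj₁ z<v) , λ z∈ → <-irrefl refl (proj₁ (∈⟨,]⁻ z∈))

    rank-squeeze : ∀ {x y z} → x < y → y ≤ z → rank z ℕ.≤ ℕ.suc (rank x) → y ≡ z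
    rank-squeeze x<y y≤z rank-z≤ = decidable-stable (_ Fin.≟ _) λ y≢z →
      ℕₚ.<⇒≱ (rank-strict x<y) (ℕₚ.≤-pred (ℕₚ.<-≤-trans (rank-strict (y≤z , y≢z)) rank-z≤))

    module Geometric (B : Subset N) (rank-⋁ : ∀ {J} → J ⊆ B → rank (⋁ L J) ≡ ∣ J ∣) where

      x∈J⇒x≰⋁J-x : ∀ {J s} → J ⊆ B → s ∈ J → ¬ s ≤ ⋁ L (J - s)
      x∈J⇒x≰⋁J-x {J} {s} J⊆B s∈J s≤⋁J-s = ℕₚ.<-irrefl ∣J-s∣≡∣J∣ (x∈p⇒∣p-x∣<∣p∣ s∈J)
        where
        ⋁J-s≡⋁J : ⋁ L (J - s) ≡ ⋁ L J
        ⋁J-s≡⋁J = antisym (⋁-mono (p─q⊆p J ⁅ s ⁆)) (⋁-least λ {i} i∈J → case (i Fin.≟ s) i∈J)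
          where
          case : ∀ {i} → Dec (i ≡ s) → i ∈ J → i ≤ ⋁ L (J - s)
          case (yes refl) _ = s≤⋁J-s
          case (no i≢s) i∈J = ∈⇒≤⋁ (x∈p∧x≢y⇒x∈p-y i∈J i≢s)

        ∣J-s∣≡∣J∣ : ∣ J - s ∣ ≡ ∣ J ∣
        ∣J-s∣≡∣J∣ = trans (sym (rank-⋁ (⊆-trans (p─q⊆p J ⁅ s ⁆) J⊆B)))
                          (trans (cong rank ⋁J-s≡⋁J) (rank-⋁ J⊆B))

      MinimalSupport : Fin N → Subset N → Set
      MinimalSupport x S = S ⊆ B × x ≤ ⋁ L S × (∀ {s} → s ∈ S → ¬ x ≤ ⋁ L (S - s))

      minimalSupport : ∀ {x} → x ≤ ⋁ L B → ∃[ S ] MinimalSupport x S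
      minimalSupport {x} x≤⋁B = minimal-subset (λ S → x ≤? ⋁ L S) x≤⋁B

      -- ⋁ (S - s) < x ∨ ⋁ (S - s) ≤ ⋁ S, and the ranks of the two ends differ by one.
      support-exchange : ∀ {x S s} → MinimalSupport x S → s ∈ S → s ≤ (x ∨ ⋁ L (S - s))
      support-exchange {x} {S} {s} (S⊆B , x≤⋁S , minimal) s∈S =
        subst (s ≤_) (sym x∨⋁S-s≡⋁S) (∈⇒≤⋁ s∈S)
        where
        S-s⊆B : S - s ⊆ B
        S-s⊆B = ⊆-trans (p─q⊆p S ⁅ s ⁆) S⊆B

        ⋁S-s<x∨⋁S-s : ⋁ L (S - s) < x ∨ ⋁ L (S - s)
        ⋁S-s<x∨⋁S-s = y≤x∨y x _ , λ ⋁S-s≡ → minimal s∈S (subst (x ≤_) (sym ⋁S-s≡) (x≤x∨y x _))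

        x∨⋁S-s≡⋁S : x ∨ ⋁ L (S - s) ≡ ⋁ L S
        x∨⋁S-s≡⋁S = rank-squeeze ⋁S-s<x∨⋁S-s (∨-least x≤⋁S (⋁-mono (p─q⊆p S ⁅ s ⁆)))
          (ℕₚ.≤-reflexive (trans (rank-⋁ S⊆B)
                          (trans (x∈p⇒∣p∣≡1+∣p-x∣ s∈S) (cong ℕ.suc (sym (rank-⋁ S-s⊆B))))))

      -- An s ∈ S outside T would satisfy s ≤ x ∨ ⋁ (S - s) ≤ ⋁ ((S ∪ T) - s).
      support-minimum : ∀ {x S T} → MinimalSupport x S → T ⊆ B → x ≤ ⋁ L T → S ⊆ T
      support-minimum {x} {S} {T} support@(S⊆B , _ , _) T⊆B x≤⋁T {s} s∈S =
        decidable-stable (s ∈? T) λ s∉T →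
          x∈J⇒x≰⋁J-x S∪T⊆B (p⊆p∪q T s∈S)
            (≤-trans (support-exchange support s∈S)
                     (∨-least (≤-trans x≤⋁T (⋁-mono (T⊆S∪T-s s∉T)))
                              (⋁-mono (p⊆q⇒p─r⊆q─r {p = S} {r = ⁅ s ⁆} (p⊆p∪q T)))))
        where
        S∪T⊆B : S ∪ T ⊆ B
        S∪T⊆B = [ S⊆B , T⊆B ]′ ∘ x∈p∪q⁻ S T

        T⊆S∪T-s : s ∉ T → T ⊆ (S ∪ T) - s
        T⊆S∪T-s s∉T t∈T = x∈p∧x≢y⇒x∈p-y (q⊆p∪q S T t∈T) λ { refl → s∉T t∈T }

  module FundamentalCircuit (rank : Fin N → ℕ) (rk : IsRankFunction L rank)
                            (B : Subset N) (basis : IsBasis L rank B)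
                            (a : Fin N) (a-atom : IsAtom L a) (a∉B : a ∉ B) where

    open Ranked rank (proj₂ (proj₂ rk))
    open Geometric B (λ J⊆B → proj₂ (proj₂ (proj₂ basis) _ J⊆B))

    B-independent : Independent L B
    B-independent = proj₁ basis

    a≤⋁B : a ≤ ⋁ L B
    a≤⋁B = decidable-stable (a ≤? ⋁ L B) λ a≰⋁B →
      a∉B (subst (a ∈_) (proj₁ (proj₂ basis) _ (Independent-∪⁅⁆ B-independent a-atom a≰⋁B) (p⊆p∪q _))
                 (q⊆p∪q B _ (x∈⁅x⁆ a)))

    S : Subset N
    S = proj₁ (minimalSupport a≤⋁B)

    S-support : MinimalSupport a S
    S-support = proj₂ (minimalSupport a≤⋁B)

    S⊆B : S ⊆ B
    S⊆B = proj₁ S-support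

    a∉S : a ∉ S
    a∉S = a∉B ∘ S⊆B

    C : Subset N
    C = S ∪ ⁅ a ⁆

    a∈C : a ∈ C
    a∈C = q⊆p∪q S _ (x∈⁅x⁆ a)

    C⊆B∪⁅a⁆ : C ⊆ B ∪ ⁅ a ⁆
    C⊆B∪⁅a⁆ = [ p⊆p∪q _ ∘ S⊆B , q⊆p∪q B _ ]′ ∘ x∈p∪q⁻ S _

    C-spanning : ∀ {d} → d ∈ C → d ≤ ⋁ L (C - d)
    C-spanning {d} d∈C with x∈p∪⁅y⁆⇒x∈p⊎x≡y d∈C
    ... | inj₂ refl = ≤-trans (proj₁ (proj₂ S-support)) (⋁-mono {S} {C - a} S⊆C-a)
      where
      S⊆C-a : S ⊆ C - a
      S⊆C-a s∈S = x∈p∧x≢y⇒x∈p-y (p⊆p∪q _ s∈S) λ { refl → a∉S s∈S }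
    ... | inj₁ s∈S = ≤-trans (support-exchange S-support s∈S)
                             (∨-least (∈⇒≤⋁ a∈C-s) (⋁-mono (p⊆q⇒p─r⊆q─r {p = S} {r = ⁅ d ⁆} (p⊆p∪q ⁅ a ⁆))))
      where
      a∈C-s : a ∈ C - d
      a∈C-s = x∈p∧x≢y⇒x∈p-y a∈C λ { refl → a∉S s∈S }

    C-dependent : Dependent L C
    C-dependent = C-atoms , λ (_ , ω , nbb) → spanning⇒¬NBB ω C-atoms a∈C C-spanning nbb
      where
      C-atoms : AtomSet L C
      C-atoms = AtomSet-∪⁅⁆ (proj₁ B-independent ∘ S⊆B) a-atom

    dependent⇒a∈ : ∀ {D} → D ⊆ B ∪ ⁅ a ⁆ → Dependent L D → a ∈ D
    dependent⇒a∈ {D} D⊆B∪⁅a⁆ (_ , D-not-independent) =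
      decidable-stable (a ∈? D) λ a∉D → D-not-independent (Independent-⊆ B-independent (D⊆B a∉D))
      where
      D⊆B : a ∉ D → D ⊆ B
      D⊆B a∉D d∈D = [ id , (λ { refl → ⊥-elim (a∉D d∈D) }) ]′ (x∈p∪⁅y⁆⇒x∈p⊎x≡y (D⊆B∪⁅a⁆ d∈D))

    dependent⇒a≤⋁∩B : ∀ {D} → D ⊆ B ∪ ⁅ a ⁆ → Dependent L D → a ≤ ⋁ L (D ∩ B)
    dependent⇒a≤⋁∩B {D} D⊆B∪⁅a⁆ (_ , D-not-independent) =
      decidable-stable (a ≤? ⋁ L (D ∩ B)) λ a≰⋁D∩B → D-not-independent
        (Independent-⊆ (Independent-∪⁅⁆ (Independent-⊆ B-independent (p∩q⊆q D B)) a-atom a≰⋁D∩B)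
                       D⊆D∩B∪⁅a⁆)
      where
      D⊆D∩B∪⁅a⁆ : D ⊆ (D ∩ B) ∪ ⁅ a ⁆
      D⊆D∩B∪⁅a⁆ d∈D = x∈p∪q⁺ (Sum.map₁ (λ d∈B → x∈p∩q⁺ (d∈D , d∈B)) (x∈p∪q⁻ B _ (D⊆B∪⁅a⁆ d∈D)))

    C⊆dependent : ∀ {D} → D ⊆ B ∪ ⁅ a ⁆ → Dependent L D → C ⊆ D
    C⊆dependent {D} D⊆B∪⁅a⁆ D-dependent d∈C with x∈p∪⁅y⁆⇒x∈p⊎x≡y d∈C
    ... | inj₁ s∈S = proj₁ (x∈p∩q⁻ D B (support-minimum S-support (p∩q⊆q D B)
                                          (dependent⇒a≤⋁∩B D⊆B∪⁅a⁆ D-dependent) s∈S))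
    ... | inj₂ refl = dependent⇒a∈ D⊆B∪⁅a⁆ D-dependent

lemma4p4 : (L : FinLattice) → Atomic L →
    (rank : Fin (FinLattice.n L) → ℕ) → IsRankFunction L rank →
    (B : Subset (FinLattice.n L)) → IsBasis L rank B →
    ∀ a → IsAtom L a → a ∉ B →
    ∃[ D ] ((D ⊆ (B ∪ ⁅ a ⁆) × MinimalDependent L D) ×
    (∀ D′ → D′ ⊆ (B ∪ ⁅ a ⁆) → MinimalDependent L D′ → D′ ≡ D))
lemma4p4 L _ rank rk B basis a a-atom a∉B =
  C , (C⊆B∪⁅a⁆ , C-dependent , C-minimal) , unique
  where
  open Lattice.FundamentalCircuit L rank rk B basis a a-atom a∉B

  C-minimal : ∀ D → D ⊆ C → Dependent L D → D ≡ C
  C-minimal D D⊆C D-dependent = ⊆-antisym D⊆C (C⊆dependent (⊆-trans D⊆C C⊆B∪⁅a⁆) D-dependent)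

  unique : ∀ D → D ⊆ B ∪ ⁅ a ⁆ → MinimalDependent L D → D ≡ C
  unique D D⊆B∪⁅a⁆ (D-dependent , D-minimal) = sym (D-minimal C (C⊆dependent D⊆B∪⁅a⁆ D-dependent) C-dependent)
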